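{- (1) $(\mathbb Q\mathcal S^{Ch},\top,\sqcup\!\sqcup)$ is a locality algebra. (2) The linear map $F:\mathbb Q\mathcal S^{Ch}\to\mathbb Q\mathcal F^{Ch}$ with $F(\mathbf 1)=1$ and $$F\binom{s_1,\dots,s_k}{i_1,\dots,i_k}=f\binom{s_1,\dots,s_k}{x_{i_1},\dots,x_{i_k}}$$ is a locality algebra homomorphism. That is, $F(a\sqcup\!\sqcup b)=F(a)F(b)$ for all Chen symbols $a,b$ with $a\top b$.
   Context: Two-row algebra. Let $\mathcal H_{\mathbb Z\times\mathbb Z_{\ge1}}$ have basis $\mathbf 1$ together with the formal symbols $\binom{\vec s}{\vec u}=\binom{s_1,\dots,s_k}{u_1,\dots,u_k}$ ($k\ge1$, $\vec s\in\mathbb Z^k$, $\vec u\in\mathbb Z_{\ge1}^k$). $I^S$ and $J^S$ are the linear maps adding $+1$ and $-1$ respectively to the top-left entry $s_1$, with $J^S(\mathbf 1)=0$. Write a basis element as $\binom{s_1,\vec s\,'}{u_1,\vec u'}$, where the remaining columns $\binom{\vec s\,'}{\vec u'}$ are read as $\mathbf 1$ if empty. The product $\sqcup\!\sqcup$ is bilinear with unit $\mathbf 1$, and is defined on positive-depth basis elements by: <ul> <li>(i) if $s_1=0$: the product is the column $\binom0{u_1}$ prepended to each term of $\binom{\vec s\,'}{\vec u'}\sqcup\!\sqcup\binom{t_1,\vec t\,'}{v_1,\vec v'}$;</li> <li>(ii) if $s_1>0$ and $t_1=0$: the product is the column $\binom0{v_1}$ prepended to each term of $\binom{s_1,\vec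 s\,'}{u_1,\vec u'}\sqcup\!\sqcup\binom{\vec t\,'}{\vec v'}$;</li> <li>(iii) if $s_1,t_1>0$: the product equals $I^S(\binom{s_1,\vec s\,'}{u_1,\vec u'}\sqcup\!\sqcup\binom{t_1-1,\vec t\,'}{v_1,\vec v'})+I^S(\binom{s_1-1,\vec s\,'}{u_1,\vec u'}\sqcup\!\sqcup\binom{t_1,\vec t\,'}{v_1,\vec v'})$;</li> <li>(iv) if $s_1>0$ and $t_1<0$: the product equals $J^S(\binom{s_1,\vec s\,'}{u_1,\vec u'}\sqcup\!\sqcup\binom{t_1+1,\vec t\,'}{v_1,\vec v'})-\binom{s_1-1,\vec s\,'}{u_1,\vec u'}\sqcup\!\sqcup\binom{t_1+1,\vec t\,'}{v_1,\vec v'}$;</li> <li>(v) if $s_1<0$: the product equals $J^S(\binom{s_1+1,\vec s\,'}{u_1,\vec u'}\sqcup\!\sqcup\binom{t_1,\vec t\,'}{v_1,\vec v'})-\binom{s_1+1,\vec s\,'}{u_1,\vec u'}\sqcup\!\sqcup\binom{t_1-1,\vec t\,'}{v_1,\vec v'}$.</li> </ul> Chen symbols. A Chen symbol is a basis element $\binom{\vec s}{\vec u}$ whose bottom entries are pairwise distinct. $\mathcal S^{Ch}$ is the set of Chen symbols together with $\mathbf 1$, and $\mathbb Q\mathcal S^{Ch}$ is its span. The locality relation on $\mathcal S^{Ch}$ is given by: $\mathbf 1\top a$ for all $a$, and $\binom{\vec s}{\vec u}\top\binom{\vec t}{\vec v}$ iff all entries of $\vec u$ and $\vec v$ together are distinct.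 It is extended to the span by declaring $X\top Y$ when every basis element in the support of $X$ is related to every basis element in the support of $Y$. Generalized Chen fractions. For distinct $i_1,\dots,i_k\in\mathbb Z_{\ge1}$ and $\vec s\in\mathbb Z^k$, $$f\binom{s_1,\dots,s_k}{x_{i_1},\dots,x_{i_k}}=\prod_{j=1}^k(x_{i_j}+\cdots+x_{i_k})^{ -s_j}.$$ $\mathbb Q\mathcal F^{Ch}$ is the span of these rational functions, with ordinary multiplication and with the locality relation "depending on disjoint sets of variables". A locality algebra is a vector space with a symmetric relation $\top$ whose polar sets are subspaces, with a product defined on related pairs that is bilinear and associative on mutually related triples (with the products again related appropriately). A locality algebra homomorphism is a linear map preserving $\top$ and products of related pairs. -}

module Defs where

open import Data.Nat as ℕ using (ℕ; zero; suc)
open import Data.Integer as ℤ using (ℤ; +_; -[1+_])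
open import Data.Rational as ℚ using (ℚ; 0ℚ; 1ℚ; _<_)
open import Data.Product using (_×_; _,_; proj₁; proj₂; Σ)
open import Data.Sum using (_⊎_)
open import Data.List using (List; []; _∷_; _++_; map; concatMap; foldr)
open import Data.List.Relation.Unary.All using (All)
open import Data.List.Relation.Unary.Unique.Propositional using (Unique)
open import Data.List.Membership.Propositional using (_∈_)
import Data.List.Properties as LP
import Data.Product.Properties as PP
open import Relation.Binary.PropositionalEquality using (_≡_; _≢_)
open import Relation.Nullary using (Dec; yes; no; ¬_)

-- Basis of the two-row algebra H_{Z × Z≥1}
-- A column is (s , u).  A basis element is a list of columns;
-- the empty list represents the unit 𝟏.

Col : Set
Col = ℤ × ℕ

Word : Set
Word = List Col

-- Formal Q-linear combinations of basis elements (finite lists of terms).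
Comb : Set
Comb = List (ℚ × Word)

_≟W_ : (a b : Word) → Dec (a ≡ b)
_≟W_ = LP.≡-dec (PP.≡-dec ℤ._≟_ ℕ._≟_)

coeff : Comb → Word → ℚ
coeff [] w = 0ℚ
coeff ((q , a) ∷ X) w with a ≟W w
... | yes _ = q ℚ.+ coeff X w
... | no  _ = coeff X w

_≈_ : Comb → Comb → Set
X ≈ Y = ∀ w → coeff X w ≡ coeff Y w

_∈supp_ : Word → Comb → Set
w ∈supp X = coeff X w ≢ 0ℚ

single : Word → Comb
single a = (1ℚ , a) ∷ []

scale : ℚ → Comb → Comb
scale p X = map (λ t → (p ℚ.* proj₁ t , proj₂ t)) X

neg : Comb → Comb
neg = scale (ℚ.- 1ℚ)

pre : Col → Comb → Comb
pre c X = map (λ t → (proj₁ t , c ∷ proj₂ t)) X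

-- I^S on basis elements: add 1 to top-left entry (only ever applied to
-- positive-depth elements; we set I^S(𝟏) = 0, never used)
Iw : ℚ × Word → Comb
Iw (q , [])           = []
Iw (q , (s , u) ∷ w)  = (q , (s ℤ.+ ℤ.1ℤ , u) ∷ w) ∷ []

-- J^S: subtract 1 from top-left entry, J^S(𝟏) = 0
Jw : ℚ × Word → Comb
Jw (q , [])           = []
Jw (q , (s , u) ∷ w)  = (q , (s ℤ.- ℤ.1ℤ , u) ∷ w) ∷ []

IS JS : Comb → Comb
IS = concatMap Iw
JS = concatMap Jw

-- The product ⧢ on basis elements.
-- shF n a b is the product a ⧢ b, provided n ≥ depth a + depth b
-- (the fuel n is only a termination device; it never runs out, see sh).
-- The helpers g, gP, … treat the case where both a, b have positive depth,
-- with heads (s,u), (t,v) and tails x, y, and fuel n ≥ |x| + |y| + 1.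

mutual
  shF : ℕ → Word → Word → Comb
  shF _       []      b        = single b
  shF _       (c ∷ x) []       = single (c ∷ x)
  shF zero    (_ ∷ _) (_ ∷ _)  = []   -- unreachable
  shF (suc n) ((s , u) ∷ x) ((t , v) ∷ y) = g n s u x t v y

  g : ℕ → ℤ → ℕ → Word → ℤ → ℕ → Word → Comb
  g n (+ zero)  u x t v y = pre (+ 0 , u) (shF n x ((t , v) ∷ y))
  g n (+ suc m) u x t v y = gP n m u x t v y
  g n -[1+ m ]  u x t v y = gN n m u x t v y

  gP : ℕ → ℕ → ℕ → Word → ℤ → ℕ → Word → Comb
  gP n m u x (+ k)     v y = gPz n m u x k v y
  gP n m u x -[1+ k ]  v y = gPN n m u x k v y

  gPz : ℕ → ℕ → ℕ → Word → ℕ → ℕ → Word → Comb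
  gPz n m u x zero    v y = pre (+ 0 , v) (shF n ((+ suc m , u) ∷ x) y)
  gPz n m u x (suc k) v y = gPP n m u x k v y

  gPP : ℕ → ℕ → ℕ → Word → ℕ → ℕ → Word → Comb
  gPP n zero    u x k v y =
    IS (gPz n zero u x k v y) ++ IS (pre (+ 0 , u) (shF n x ((+ suc k , v) ∷ y)))
  gPP n (suc m) u x k v y =
    IS (gPz n (suc m) u x k v y) ++ IS (gPP n m u x k v y)

  -- s = m+1, t = -[1+ k] + 1   (i.e. the product with t₁ replaced by t₁+1)
  gPN' : ℕ → ℕ → ℕ → Word → ℕ → ℕ → Word → Comb
  gPN' n m u x zero    v y = gPz n m u x zero v y
  gPN' n m u x (suc k) v y = gPN n m u x k v y

  gPN : ℕ → ℕ → ℕ → Word → ℕ → ℕ → Word → Comb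
  gPN n zero    u x k v y =
    JS (gPN' n zero u x k v y)
    ++ neg (pre (+ 0 , u) (shF n x ((-[1+ k ] ℤ.+ ℤ.1ℤ , v) ∷ y)))
  gPN n (suc m) u x k v y =
    JS (gPN' n (suc m) u x k v y) ++ neg (gPN' n m u x k v y)

  gN : ℕ → ℕ → ℕ → Word → ℤ → ℕ → Word → Comb
  gN n zero    u x t v y =
    JS (pre (+ 0 , u) (shF n x ((t , v) ∷ y)))
    ++ neg (pre (+ 0 , u) (shF n x ((t ℤ.- ℤ.1ℤ , v) ∷ y)))
  gN n (suc m) u x t v y =
    JS (gN n m u x t v y) ++ neg (gN n m u x (t ℤ.- ℤ.1ℤ) v y)

depth : Word → ℕ
depth = Data.List.length
  where import Data.List

_⧢_ : Word → Word → Comb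
a ⧢ b = shF (depth a ℕ.+ depth b) a b

_⧢ₗ_ : Comb → Comb → Comb
X ⧢ₗ Y = concatMap (λ s → concatMap (λ t →
           scale (proj₁ s ℚ.* proj₁ t) (proj₂ s ⧢ proj₂ t)) Y) X

bottoms : Word → List ℕ
bottoms = map proj₂

-- membership in S^Ch (the empty word 𝟏 is included): bottom entries are
-- ≥ 1 (basis of H_{Z×Z≥1}) and pairwise distinct
Chen : Word → Set
Chen w = All (λ u → 1 ℕ.≤ u) (bottoms w) × Unique (bottoms w)

_⊤_ : Word → Word → Set
a ⊤ b = (a ≡ []) ⊎ (b ≡ []) ⊎ Unique (bottoms a ++ bottoms b)

InSpanCh : Comb → Set
InSpanCh X = ∀ w → w ∈supp X → Chen w

_⊤ₗ_ : Comb → Comb → Set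
X ⊤ₗ Y = ∀ a b → a ∈supp X → b ∈supp Y → a ⊤ b

-- Generalized Chen fractions, evaluated at rational points
-- Points: x : ℕ → ℚ (x i is the value of the variable x_i).

Positive : (ℕ → ℚ) → Set
Positive x = ∀ i → 0ℚ < x i

_^ℕ_ : ℚ → ℕ → ℚ
q ^ℕ zero  = 1ℚ
q ^ℕ suc n = q ℚ.* (q ^ℕ n)

-- inverse, with the (irrelevant) convention 1/0 = 0
inv : ℚ → ℚ
inv q with q ℚ.≟ 0ℚ
... | yes _ = 0ℚ
... | no q≢0 = ℚ.1/_ q {{ℚ.≢-nonZero q≢0}}

powNeg : ℚ → ℤ → ℚ
powNeg q (+ n)     = inv (q ^ℕ n)
powNeg q -[1+ n ]  = q ^ℕ suc n

sumVars : (ℕ → ℚ) → List ℕ → ℚ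
sumVars x = foldr (λ i r → x i ℚ.+ r) 0ℚ

-- F on basis elements, evaluated at x:
--   F (s₁..s_k ; i₁..i_k) (x) = ∏_j (x_{i_j} + ⋯ + x_{i_k})^{-s_j},  F(𝟏) = 1
evalF : Word → (ℕ → ℚ) → ℚ
evalF []             x = 1ℚ
evalF ((s , i) ∷ w)  x = powNeg (sumVars x (i ∷ bottoms w)) s ℚ.* evalF w x

evalFₗ : Comb → (ℕ → ℚ) → ℚ
evalFₗ X x = foldr (λ t r → proj₁ t ℚ.* evalF (proj₂ t) x ℚ.+ r) 0ℚ X

DependsOnly : ((ℕ → ℚ) → ℚ) → List ℕ → Set
DependsOnly f S = ∀ x y → Positive x → Positive y →
                  (∀ i → i ∈ S → x i ≡ y i) → f x ≡ f y

_⊤F_ : ((ℕ → ℚ) → ℚ) → ((ℕ → ℚ) → ℚ) → Set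
f ⊤F h = Σ (List ℕ) λ S → Σ (List ℕ) λ T →
           (∀ i → i ∈ S → ¬ (i ∈ T)) × DependsOnly f S × DependsOnly h T

{-# OPTIONS --safe #-}
-- Everything rests on one identity: lowering the top-left entry (J^S) is a
-- derivation of ⧢ on positive-depth symbols.  Tested against any functional φ,
--   φ(J^S(a ⧢ b)) = φ(J^S a ⧢ b) + φ(a ⧢ J^S b)      (⧢-leibniz),
-- which is rule (iii), (iv) or (v) rearranged.  Consequently the associator of
-- a, b, c tested against φ ∘ J^S is the sum of the three associators with one
-- top-left exponent lowered, so associativity at any three of these four
-- triples gives the fourth.  Rules (i) and (ii) strip a leading zero column and
-- reduce to shorter symbols, and from there the relation reaches every integer
-- exponent (exponent-induction³).  The same scheme proves F(a ⧢ b) = F(a) F(b):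
-- F(J^S w) = (x_{i₁} + ⋯ + x_{i_k}) F(w) with a positive factor, so the defect
-- F(a ⧢ b) - F(a) F(b) obeys the two-term analogue (defect-leibniz).  Neither
-- argument uses locality.  The locality statements hold because the bottom row
-- of every term of a ⧢ b is a permutation of those of a and b, and because the
-- coefficient of w in X ⧢ₗ Y is the functional indicator w applied to it.
module Submission where

open import Defs
open import Data.Nat as ℕ using (ℕ; zero; suc)
import Data.Nat.Properties as ℕP
open import Data.Empty using (⊥; ⊥-elim)
open import Data.Integer as ℤ using (ℤ; +_; -[1+_]; 0ℤ; 1ℤ; +≤+; -≤+)
import Data.Integer.Properties as ℤP
open import Data.List using (List; []; _∷_; _++_; map; concatMap; foldr; length; filter)
import Data.List.Properties as LP
open import Data.List.Membership.Propositional using (_∈_)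
import Data.List.Membership.Propositional.Properties as MP
open import Data.List.Relation.Binary.Disjoint.DecPropositional ℕ._≟_ using (Disjoint; disjoint?)
open import Data.List.Relation.Binary.Permutation.Propositional
  using (_↭_; prep; ↭-sym; ↭-trans; ↭-refl; ↭-reflexive; ↭⇒↭ₛ)
import Data.List.Relation.Binary.Permutation.Propositional.Properties as PermP
import Data.List.Relation.Binary.Permutation.Setoid.Properties as PermₛP
open import Data.List.Relation.Unary.All as All using (All; []; _∷_)
import Data.List.Relation.Unary.All.Properties as AllP
open import Data.List.Relation.Unary.AllPairs using (_∷_)
open import Data.List.Relation.Unary.Any using (here; there)
open import Data.List.Relation.Unary.Unique.Propositional using (Unique)
import Data.List.Relation.Unary.Unique.Propositional.Properties as UP
open import Data.List.Relation.Unary.Unique.DecPropositional ℕ._≟_ using (unique?)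
open import Data.Product using (_×_; _,_; proj₁; proj₂)
open import Data.Rational as ℚ using (ℚ; 0ℚ; 1ℚ; _*_; _+_; _-_; -_; _<_; _≤_)
open import Data.Rational.Properties
open import Data.Rational.Solver using (module +-*-Solver)
open import Algebra.Properties.AbelianGroup +-0-abelianGroup
  using (x∙y⁻¹≈ε⇒x≈y; x≈y⇒x∙y⁻¹≈ε; //-rightDividesˡ)
open import Algebra.Properties.Ring +-*-ring using (-1*x≈-x)
open import Data.Sum using (inj₁; inj₂)
open import Data.Unit using (tt) renaming (⊤ to 𝟙)
open import Function using (_∘_)
open import Relation.Binary.PropositionalEquality
open import Relation.Nullary using (Dec; yes; no; ¬?)
open import Relation.Nullary.Decidable using (_×-dec_)
open ≡-Reasoning

module _ {w x y : ℚ} (w≡x+y : w ≡ x + y) where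

  zero-summandˡ : w ≡ 0ℚ → y ≡ 0ℚ → x ≡ 0ℚ
  zero-summandˡ w≡0 y≡0 = begin
    x        ≡⟨ +-identityʳ x ⟨
    x + 0ℚ   ≡⟨ cong (_+_ x) y≡0 ⟨
    x + y    ≡⟨ w≡x+y ⟨
    w        ≡⟨ w≡0 ⟩
    0ℚ       ∎

  zero-summandʳ : w ≡ 0ℚ → x ≡ 0ℚ → y ≡ 0ℚ
  zero-summandʳ w≡0 x≡0 = begin
    y        ≡⟨ +-identityˡ y ⟨
    0ℚ + y   ≡⟨ cong (_+ y) x≡0 ⟨
    x + y    ≡⟨ w≡x+y ⟨
    w        ≡⟨ w≡0 ⟩
    0ℚ       ∎

  zero-sum : x ≡ 0ℚ → y ≡ 0ℚ → w ≡ 0ℚ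
  zero-sum x≡0 y≡0 = trans w≡x+y (cong₂ _+_ x≡0 y≡0)

zero-factor : ∀ c d → c ≢ 0ℚ → c * d ≡ 0ℚ → d ≡ 0ℚ
zero-factor c d c≢0 cd≡0 = begin
  d                ≡⟨ *-identityˡ d ⟨
  1ℚ * d           ≡⟨ cong (_* d) (*-inverseˡ c) ⟨
  (1/c * c) * d    ≡⟨ *-assoc 1/c c d ⟩
  1/c * (c * d)    ≡⟨ cong (_*_ 1/c) cd≡0 ⟩
  1/c * 0ℚ         ≡⟨ *-zeroʳ 1/c ⟩
  0ℚ               ∎
  where
  instance
    c≠0 : ℚ.NonZero c
    c≠0 = ℚ.≢-nonZero c≢0
  1/c : ℚ
  1/c = ℚ.1/ c

downward-induction : (Q : ℤ → Set) → (∀ n → Q (+ n)) → (∀ s → Q s → Q (s ℤ.- 1ℤ)) → ∀ s → Q s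
downward-induction Q nonNeg step (+ n)        = nonNeg n
downward-induction Q nonNeg step -[1+ zero ]  = step (+ 0) (nonNeg 0)
downward-induction Q nonNeg step -[1+ suc m ] =
  subst Q (ℤP.neg-minus-pos m 1) (step -[1+ m ] (downward-induction Q nonNeg step -[1+ m ]))

module _ (P : ℤ → ℤ → Set)
  (base-i  : ∀ t → P 0ℤ t)
  (base-ii : ∀ m → P (+ suc m) 0ℤ)
  (lower₁  : ∀ s t → P s t → P s (t ℤ.- 1ℤ) → P (s ℤ.- 1ℤ) t)
  (lower₂  : ∀ s t → P s t → P (s ℤ.- 1ℤ) t → P s (t ℤ.- 1ℤ))
  (unlower : ∀ s t → P (s ℤ.- 1ℤ) t → P s (t ℤ.- 1ℤ) → P s t)
  where

  exponent-induction² : ∀ s t → P s t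
  exponent-induction² = downward-induction (λ s → ∀ t → P s t) nonNegative
    (λ s P[s] t → lower₁ s t (P[s] t) (P[s] (t ℤ.- 1ℤ)))
    where
    nonNegative : ∀ n t → P (+ n) t
    nonNegative zero    = base-i
    nonNegative (suc m) = downward-induction (P (+ suc m)) nonNegative₂
      (λ t P[t] → lower₂ (+ suc m) t P[t] (nonNegative m t))
      where
      nonNegative₂ : ∀ k → P (+ suc m) (+ k)
      nonNegative₂ zero    = base-ii m
      nonNegative₂ (suc k) = unlower (+ suc m) (+ suc k) (nonNegative m (+ suc k)) (nonNegative₂ k)

module _ (P : ℤ → ℤ → ℤ → Set)
  (base-i   : ∀ t r → P 0ℤ t r)
  (base-ii  : ∀ m r → P (+ suc m) 0ℤ r)
  (base-iii : ∀ m k → P (+ suc m) (+ suc k) 0ℤ)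
  (lower₁   : ∀ s t r → P s t r → P s (t ℤ.- 1ℤ) r → P s t (r ℤ.- 1ℤ) → P (s ℤ.- 1ℤ) t r)
  (lower₂   : ∀ s t r → P s t r → P (s ℤ.- 1ℤ) t r → P s t (r ℤ.- 1ℤ) → P s (t ℤ.- 1ℤ) r)
  (lower₃   : ∀ s t r → P s t r → P (s ℤ.- 1ℤ) t r → P s (t ℤ.- 1ℤ) r → P s t (r ℤ.- 1ℤ))
  (unlower  : ∀ s t r → P (s ℤ.- 1ℤ) t r → P s (t ℤ.- 1ℤ) r → P s t (r ℤ.- 1ℤ) → P s t r)
  where

  exponent-induction³ : ∀ s t r → P s t r
  exponent-induction³ = downward-induction (λ s → ∀ t r → P s t r) nonNegative
    (λ s P[s] t r → lower₁ s t r (P[s] t r) (P[s] (t ℤ.- 1ℤ) r) (P[s] t (r ℤ.- 1ℤ)))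
    where
    nonNegative : ∀ n t r → P (+ n) t r
    nonNegative zero    = base-i
    nonNegative (suc m) = downward-induction (λ t → ∀ r → P (+ suc m) t r) nonNegative₂
      (λ t P[t] r → lower₂ (+ suc m) t r (P[t] r) (nonNegative m t r) (P[t] (r ℤ.- 1ℤ)))
      where
      nonNegative₂ : ∀ k r → P (+ suc m) (+ k) r
      nonNegative₂ zero    = base-ii m
      nonNegative₂ (suc k) = downward-induction (P (+ suc m) (+ suc k)) nonNegative₃
        (λ r P[r] → lower₃ (+ suc m) (+ suc k) r P[r] (nonNegative m (+ suc k) r) (nonNegative₂ k r))
        where
        nonNegative₃ : ∀ i → P (+ suc m) (+ suc k) (+ i)
        nonNegative₃ zero    = base-iii m k
        nonNegative₃ (suc i) = unlower (+ suc m) (+ suc k) (+ suc i)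
          (nonNegative m (+ suc k) (+ suc i)) (nonNegative₂ k (+ suc i)) (nonNegative₃ i)

linExt : (Word → ℚ) → Comb → ℚ
linExt φ = foldr (λ t r → proj₁ t * φ (proj₂ t) + r) 0ℚ

AllWords : (Word → Set) → Comb → Set
AllWords P = All (P ∘ proj₂)

linExt-++ : ∀ φ X Y → linExt φ (X ++ Y) ≡ linExt φ X + linExt φ Y
linExt-++ φ []            Y = sym (+-identityˡ _)
linExt-++ φ ((q , a) ∷ X) Y =
  trans (cong (_+_ (q * φ a)) (linExt-++ φ X Y)) (sym (+-assoc (q * φ a) _ _))

linExt-cong : ∀ {φ ψ} X → (∀ w → φ w ≡ ψ w) → linExt φ X ≡ linExt ψ X
linExt-cong []            φ≗ψ = refl
linExt-cong ((q , a) ∷ X) φ≗ψ = cong₂ _+_ (cong (q *_) (φ≗ψ a)) (linExt-cong X φ≗ψ)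

linExt-cong-on : ∀ {φ ψ} X → AllWords (λ w → φ w ≡ ψ w) X → linExt φ X ≡ linExt ψ X
linExt-cong-on []            []            = refl
linExt-cong-on ((q , a) ∷ X) (φa≡ψa ∷ eqs) = cong₂ _+_ (cong (q *_) φa≡ψa) (linExt-cong-on X eqs)

linExt-zero : ∀ X → linExt (λ _ → 0ℚ) X ≡ 0ℚ
linExt-zero []            = refl
linExt-zero ((q , a) ∷ X) = trans (cong₂ _+_ (*-zeroʳ q) (linExt-zero X)) (+-identityʳ 0ℚ)

linExt-+ : ∀ φ ψ X → linExt (λ w → φ w + ψ w) X ≡ linExt φ X + linExt ψ X
linExt-+ φ ψ []            = sym (+-identityˡ 0ℚ)
linExt-+ φ ψ ((q , a) ∷ X) = begin
  q * (φ a + ψ a) + linExt (λ w → φ w + ψ w) X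
    ≡⟨ cong₂ _+_ (*-distribˡ-+ q (φ a) (ψ a)) (linExt-+ φ ψ X) ⟩
  (q * φ a + q * ψ a) + (linExt φ X + linExt ψ X)
    ≡⟨ +-interchange (q * φ a) (q * ψ a) _ _ ⟩
  (q * φ a + linExt φ X) + (q * ψ a + linExt ψ X) ∎
  where
  +-interchange : ∀ a b c d → (a + b) + (c + d) ≡ (a + c) + (b + d)
  +-interchange = solve 4 (λ a b c d → (a :+ b) :+ (c :+ d) := (a :+ c) :+ (b :+ d)) refl
    where open +-*-Solver

linExt-* : ∀ c φ X → linExt (λ w → c * φ w) X ≡ c * linExt φ X
linExt-* c φ []            = sym (*-zeroʳ c)
linExt-* c φ ((q , a) ∷ X) = begin
  q * (c * φ a) + linExt (λ w → c * φ w) X ≡⟨ cong₂ _+_ (*-left-commute q c (φ a)) (linExt-* c φ X) ⟩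
  c * (q * φ a) + c * linExt φ X          ≡⟨ *-distribˡ-+ c _ _ ⟨
  c * (q * φ a + linExt φ X)              ∎
  where
  *-left-commute : ∀ a b c → a * (b * c) ≡ b * (a * c)
  *-left-commute = solve 3 (λ a b c → a :* (b :* c) := b :* (a :* c)) refl
    where open +-*-Solver

linExt-swap : ∀ (f : Word → Word → ℚ) X Z →
  linExt (λ a → linExt (f a) Z) X ≡ linExt (λ c → linExt (λ a → f a c) X) Z
linExt-swap f []            Z = sym (linExt-zero Z)
linExt-swap f ((q , a) ∷ X) Z = begin
  q * linExt (f a) Z + linExt (λ a → linExt (f a) Z) X
    ≡⟨ cong₂ _+_ (sym (linExt-* q (f a) Z)) (linExt-swap f X Z) ⟩
  linExt (λ c → q * f a c) Z + linExt (λ c → linExt (λ a → f a c) X) Z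
    ≡⟨ linExt-+ (λ c → q * f a c) (λ c → linExt (λ a → f a c) X) Z ⟨
  linExt (λ c → q * f a c + linExt (λ a → f a c) X) Z ∎

linExt-concatMap : ∀ {φ ψ} (f : ℚ × Word → Comb) →
  (∀ q w → linExt φ (f (q , w)) ≡ q * ψ w) → ∀ X → linExt φ (concatMap f X) ≡ linExt ψ X
linExt-concatMap f f≗ []            = refl
linExt-concatMap f f≗ ((q , w) ∷ X) =
  trans (linExt-++ _ (f (q , w)) _) (cong₂ _+_ (f≗ q w) (linExt-concatMap f f≗ X))

linExt-single : ∀ φ w → linExt φ (single w) ≡ φ w
linExt-single φ w = trans (+-identityʳ _) (*-identityˡ _)

linExt-scale : ∀ φ p X → linExt φ (scale p X) ≡ p * linExt φ X
linExt-scale φ p []            = sym (*-zeroʳ p)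
linExt-scale φ p ((q , a) ∷ X) =
  trans (cong₂ _+_ (*-assoc p q (φ a)) (linExt-scale φ p X)) (sym (*-distribˡ-+ p _ _))

linExt-neg : ∀ φ X → linExt φ (neg X) ≡ - linExt φ X
linExt-neg φ X = trans (linExt-scale φ (- 1ℚ) X) (-1*x≈-x _)

linExt-pre : ∀ φ c X → linExt φ (pre c X) ≡ linExt (φ ∘ (c ∷_)) X
linExt-pre φ c []            = refl
linExt-pre φ c ((q , a) ∷ X) = cong (_+_ (q * φ (c ∷ a))) (linExt-pre φ c X)

linExt-⧢ₗ : ∀ φ X Y → linExt φ (X ⧢ₗ Y) ≡ linExt (λ a → linExt (λ b → linExt φ (a ⧢ b)) Y) X
linExt-⧢ₗ φ X Y = linExt-concatMap _ row X
  where
  row : ∀ p a → linExt φ (concatMap (λ t → scale (p * proj₁ t) (a ⧢ proj₂ t)) Y)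
              ≡ p * linExt (λ b → linExt φ (a ⧢ b)) Y
  row p a = trans (linExt-concatMap _ entry Y) (linExt-* p _ Y)
    where
    entry : ∀ q b → linExt φ (scale (p * q) (a ⧢ b)) ≡ q * (p * linExt φ (a ⧢ b))
    entry q b = begin
      linExt φ (scale (p * q) (a ⧢ b)) ≡⟨ linExt-scale φ (p * q) (a ⧢ b) ⟩
      p * q * linExt φ (a ⧢ b)         ≡⟨ cong (_* linExt φ (a ⧢ b)) (*-comm p q) ⟩
      q * p * linExt φ (a ⧢ b)         ≡⟨ *-assoc q p _ ⟩
      q * (p * linExt φ (a ⧢ b))       ∎

NonEmpty : Word → Set
NonEmpty []      = ⊥
NonEmpty (_ ∷ _) = 𝟙

HeadPositive HeadNonNegative : Word → Set
HeadPositive ((+ suc _ , _) ∷ _) = 𝟙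
HeadPositive _                   = ⊥
HeadNonNegative ((+ _ , _) ∷ _) = 𝟙
HeadNonNegative _               = ⊥

⧢-identityʳ : ∀ a → a ⧢ [] ≡ single a
⧢-identityʳ []      = refl
⧢-identityʳ (_ ∷ _) = refl

⧢-i : ∀ u x b → ((+ 0 , u) ∷ x) ⧢ b ≡ pre (+ 0 , u) (x ⧢ b)
⧢-i u []      []      = refl
⧢-i u (_ ∷ _) []      = refl
⧢-i u x       (_ ∷ _) = refl

⧢-ii : ∀ a → HeadPositive a → ∀ v y → a ⧢ ((+ 0 , v) ∷ y) ≡ pre (+ 0 , v) (a ⧢ y)
⧢-ii ((+ suc m , u) ∷ x) _ v y =
  cong (λ n → pre (+ 0 , v) (shF n ((+ suc m , u) ∷ x) y)) (ℕP.+-suc (length x) (length y))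

⧢-iii : ∀ m u x k v y →
  ((+ suc m , u) ∷ x) ⧢ ((+ suc k , v) ∷ y)
  ≡ IS (((+ suc m , u) ∷ x) ⧢ ((+ k , v) ∷ y)) ++ IS (((+ m , u) ∷ x) ⧢ ((+ suc k , v) ∷ y))
⧢-iii zero    u x k v y = refl
⧢-iii (suc m) u x k v y = refl

-- Rules (iv) and (v), read at t₁ - 1 (resp. s₁ - 1) with t₁ ≤ 0 (resp. s₁ ≤ 0).
⧢-iv : ∀ m u x t v y → t ℤ.≤ 0ℤ →
  ((+ suc m , u) ∷ x) ⧢ ((t ℤ.- 1ℤ , v) ∷ y)
  ≡ JS (((+ suc m , u) ∷ x) ⧢ ((t , v) ∷ y)) ++ neg (((+ m , u) ∷ x) ⧢ ((t , v) ∷ y))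
⧢-iv zero    u x (+ 0)    v y _ = refl
⧢-iv (suc m) u x (+ 0)    v y _ = refl
⧢-iv zero    u x -[1+ k ] v y _ = cong (λ t → ((+ 1 , u) ∷ x) ⧢ ((t , v) ∷ y)) (ℤP.neg-minus-pos k 1)
⧢-iv (suc m) u x -[1+ k ] v y _ = cong (λ t → ((+ suc (suc m) , u) ∷ x) ⧢ ((t , v) ∷ y)) (ℤP.neg-minus-pos k 1)
⧢-iv _       u x (+ suc _) v y (+≤+ ())

⧢-v : ∀ s u x t v y → s ℤ.≤ 0ℤ →
  ((s ℤ.- 1ℤ , u) ∷ x) ⧢ ((t , v) ∷ y)
  ≡ JS (((s , u) ∷ x) ⧢ ((t , v) ∷ y)) ++ neg (((s , u) ∷ x) ⧢ ((t ℤ.- 1ℤ , v) ∷ y))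
⧢-v (+ 0)    u x t v y _ = refl
⧢-v -[1+ m ] u x t v y _ = cong (λ s → ((s , u) ∷ x) ⧢ ((t , v) ∷ y)) (ℤP.neg-minus-pos m 1)
⧢-v (+ suc _) u x t v y (+≤+ ())

AllWords-IS : ∀ {P Q : Word → Set} X → (∀ s u w → P ((s , u) ∷ w) → Q ((s ℤ.+ 1ℤ , u) ∷ w)) →
  AllWords P X → AllWords Q (IS X)
AllWords-IS []                      P⇒Q []       = []
AllWords-IS ((q , []) ∷ X)          P⇒Q (_ ∷ ps) = AllWords-IS X P⇒Q ps
AllWords-IS ((q , (s , u) ∷ w) ∷ X) P⇒Q (p ∷ ps) = P⇒Q s u w p ∷ AllWords-IS X P⇒Q ps

AllWords-JS : ∀ {P Q : Word → Set} X → (∀ s u w → P ((s , u) ∷ w) → Q ((s ℤ.- 1ℤ , u) ∷ w)) →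
  AllWords P X → AllWords Q (JS X)
AllWords-JS []                      P⇒Q []       = []
AllWords-JS ((q , []) ∷ X)          P⇒Q (_ ∷ ps) = AllWords-JS X P⇒Q ps
AllWords-JS ((q , (s , u) ∷ w) ∷ X) P⇒Q (p ∷ ps) = P⇒Q s u w p ∷ AllWords-JS X P⇒Q ps

AllWords-pre : ∀ {P : Word → Set} c X → AllWords (P ∘ (c ∷_)) X → AllWords P (pre c X)
AllWords-pre c X = AllP.map⁺

AllWords-neg : ∀ {P : Word → Set} X → AllWords P X → AllWords P (neg X)
AllWords-neg X = AllP.map⁺

BottomsPerm : List ℕ → Word → Set
BottomsPerm K m = bottoms m ↭ K

private
  Perms : ℕ → Word → ℕ → Word → Comb → Set
  Perms u x v y = AllWords (BottomsPerm (u ∷ bottoms x ++ v ∷ bottoms y))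

  pre-u : ∀ u x v y X → AllWords (BottomsPerm (bottoms x ++ v ∷ bottoms y)) X → Perms u x v y (pre (+ 0 , u) X)
  pre-u u x v y X ps = AllWords-pre _ X (All.map (prep u) ps)

  pre-v : ∀ u x v y X → AllWords (BottomsPerm (u ∷ bottoms x ++ bottoms y)) X → Perms u x v y (pre (+ 0 , v) X)
  pre-v u x v y X ps =
    AllWords-pre _ X (All.map (λ p → ↭-trans (prep v p) (↭-sym (PermP.shift v (u ∷ bottoms x) (bottoms y)))) ps)

  IS-perm : ∀ {u x v y} X → Perms u x v y X → Perms u x v y (IS X)
  IS-perm X = AllWords-IS X (λ _ _ _ p → p)

  JS-perm : ∀ {u x v y} X → Perms u x v y X → Perms u x v y (JS X)
  JS-perm X = AllWords-JS X (λ _ _ _ p → p)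

  neg-perm : ∀ {u x v y} X → Perms u x v y X → Perms u x v y (neg X)
  neg-perm = AllWords-neg

  mutual
    shF-perm : ∀ n a b → AllWords (BottomsPerm (bottoms a ++ bottoms b)) (shF n a b)
    shF-perm _       []            b             = ↭-refl ∷ []
    shF-perm _       (c ∷ x)       []            = ↭-reflexive (sym (LP.++-identityʳ _)) ∷ []
    shF-perm zero    (_ ∷ _)       (_ ∷ _)       = []
    shF-perm (suc n) ((s , u) ∷ x) ((t , v) ∷ y) = g-perm n s u x t v y

    g-perm : ∀ n s u x t v y → Perms u x v y (g n s u x t v y)
    g-perm n (+ zero)  u x t v y = pre-u u x v y _ (shF-perm n x ((t , v) ∷ y))
    g-perm n (+ suc m) u x t v y = gP-perm n m u x t v y
    g-perm n -[1+ m ]  u x t v y = gN-perm n m u x t v y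

    gP-perm : ∀ n m u x t v y → Perms u x v y (gP n m u x t v y)
    gP-perm n m u x (+ k)    v y = gPz-perm n m u x k v y
    gP-perm n m u x -[1+ k ] v y = gPN-perm n m u x k v y

    gPz-perm : ∀ n m u x k v y → Perms u x v y (gPz n m u x k v y)
    gPz-perm n m u x zero    v y = pre-v u x v y _ (shF-perm n ((+ suc m , u) ∷ x) y)
    gPz-perm n m u x (suc k) v y = gPP-perm n m u x k v y

    gPP-perm : ∀ n m u x k v y → Perms u x v y (gPP n m u x k v y)
    gPP-perm n zero u x k v y = AllP.++⁺
      (IS-perm _ (gPz-perm n zero u x k v y))
      (IS-perm _ (pre-u u x v y _ (shF-perm n x ((+ suc k , v) ∷ y))))
    gPP-perm n (suc m) u x k v y = AllP.++⁺
      (IS-perm _ (gPz-perm n (suc m) u x k v y)) (IS-perm _ (gPP-perm n m u x k v y))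

    gPN′-perm : ∀ n m u x k v y → Perms u x v y (gPN' n m u x k v y)
    gPN′-perm n m u x zero    v y = gPz-perm n m u x zero v y
    gPN′-perm n m u x (suc k) v y = gPN-perm n m u x k v y

    gPN-perm : ∀ n m u x k v y → Perms u x v y (gPN n m u x k v y)
    gPN-perm n zero u x k v y = AllP.++⁺
      (JS-perm _ (gPN′-perm n zero u x k v y))
      (neg-perm _ (pre-u u x v y _ (shF-perm n x ((-[1+ k ] ℤ.+ 1ℤ , v) ∷ y))))
    gPN-perm n (suc m) u x k v y = AllP.++⁺
      (JS-perm _ (gPN′-perm n (suc m) u x k v y)) (neg-perm _ (gPN′-perm n m u x k v y))

    gN-perm : ∀ n m u x t v y → Perms u x v y (gN n m u x t v y)
    gN-perm n zero u x t v y = AllP.++⁺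
      (JS-perm _ (pre-u u x v y _ (shF-perm n x ((t , v) ∷ y))))
      (neg-perm _ (pre-u u x v y _ (shF-perm n x ((t ℤ.- 1ℤ , v) ∷ y))))
    gN-perm n (suc m) u x t v y = AllP.++⁺
      (JS-perm _ (gN-perm n m u x t v y)) (neg-perm _ (gN-perm n m u x (t ℤ.- 1ℤ) v y))

⧢-bottoms : ∀ a b → AllWords (BottomsPerm (bottoms a ++ bottoms b)) (a ⧢ b)
⧢-bottoms a b = shF-perm _ a b

⧢-nonEmpty : ∀ a b → NonEmpty a → AllWords NonEmpty (a ⧢ b)
⧢-nonEmpty (c ∷ x) b _ = All.map nonEmpty (⧢-bottoms (c ∷ x) b)
  where
  nonEmpty : ∀ {m} → BottomsPerm (bottoms (c ∷ x) ++ bottoms b) m → NonEmpty m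
  nonEmpty {[]}    p = PermP.¬x∷xs↭[] (↭-sym p)
  nonEmpty {_ ∷ _} _ = tt

mutual
  ⧢-headNonNegative : ∀ m u x k v y → AllWords HeadNonNegative (((+ m , u) ∷ x) ⧢ ((+ k , v) ∷ y))
  ⧢-headNonNegative zero    u x k v y rewrite ⧢-i u x ((+ k , v) ∷ y) =
    AllWords-pre _ _ (All.universal (λ _ → tt) _)
  ⧢-headNonNegative (suc m) u x zero v y rewrite ⧢-ii ((+ suc m , u) ∷ x) tt v y =
    AllWords-pre _ _ (All.universal (λ _ → tt) _)
  ⧢-headNonNegative (suc m) u x (suc k) v y = All.map positive⇒nonNegative (⧢-headPositive m u x k v y)
    where
    positive⇒nonNegative : ∀ {w} → HeadPositive w → HeadNonNegative w
    positive⇒nonNegative {(+ _ , _) ∷ _} _ = tt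

  ⧢-headPositive : ∀ m u x k v y → AllWords HeadPositive (((+ suc m , u) ∷ x) ⧢ ((+ suc k , v) ∷ y))
  ⧢-headPositive m u x k v y rewrite ⧢-iii m u x k v y = AllP.++⁺
    (AllWords-IS _ raise (⧢-headNonNegative (suc m) u x k v y))
    (AllWords-IS _ raise (⧢-headNonNegative m u x (suc k) v y))
    where
    raise : ∀ s u w → HeadNonNegative ((s , u) ∷ w) → HeadPositive ((s ℤ.+ 1ℤ , u) ∷ w)
    raise (+ n) u w _ rewrite ℕP.+-comm n 1 = tt

lower : Word → Word
lower []            = []
lower ((s , u) ∷ w) = (s ℤ.- 1ℤ , u) ∷ w

raiseᵀ lowerᵀ : (Word → ℚ) → Word → ℚ
raiseᵀ φ []            = 0ℚ
raiseᵀ φ ((s , u) ∷ w) = φ ((s ℤ.+ 1ℤ , u) ∷ w)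
lowerᵀ φ []            = 0ℚ
lowerᵀ φ ((s , u) ∷ w) = φ ((s ℤ.- 1ℤ , u) ∷ w)

linExt-IS : ∀ φ X → linExt φ (IS X) ≡ linExt (raiseᵀ φ) X
linExt-IS φ = linExt-concatMap Iw term
  where
  term : ∀ q w → linExt φ (Iw (q , w)) ≡ q * raiseᵀ φ w
  term q []      = sym (*-zeroʳ q)
  term q (_ ∷ _) = +-identityʳ _

linExt-JS : ∀ φ X → linExt φ (JS X) ≡ linExt (lowerᵀ φ) X
linExt-JS φ = linExt-concatMap Jw term
  where
  term : ∀ q w → linExt φ (Jw (q , w)) ≡ q * lowerᵀ φ w
  term q []      = sym (*-zeroʳ q)
  term q (_ ∷ _) = +-identityʳ _

raiseᵀ-lowerᵀ : ∀ φ w → NonEmpty w → raiseᵀ (lowerᵀ φ) w ≡ φ w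
raiseᵀ-lowerᵀ φ ((s , u) ∷ w) _ =
  cong (λ s → φ ((s , u) ∷ w)) (trans (ℤP.+-assoc s 1ℤ (ℤ.- 1ℤ)) (ℤP.+-identityʳ s))

lowerᵀ-raiseᵀ : ∀ φ w → NonEmpty w → lowerᵀ (raiseᵀ φ) w ≡ φ w
lowerᵀ-raiseᵀ φ ((s , u) ∷ w) _ =
  cong (λ s → φ ((s , u) ∷ w)) (trans (ℤP.+-assoc s (ℤ.- 1ℤ) 1ℤ) (ℤP.+-identityʳ s))

linExt-JS-neg : ∀ φ P Q → linExt φ (JS P ++ neg Q) ≡ linExt (lowerᵀ φ) P - linExt φ Q
linExt-JS-neg φ P Q = trans (linExt-++ φ (JS P) (neg Q)) (cong₂ _+_ (linExt-JS φ P) (linExt-neg φ Q))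

module _ (φ : Word → ℚ) (A B A′ B′ : Word) where
  private
    Leibniz : Set
    Leibniz = linExt (lowerᵀ φ) (A ⧢ B) ≡ linExt φ (A′ ⧢ B) + linExt φ (A ⧢ B′)

  leibniz-from-iv : A ⧢ B′ ≡ JS (A ⧢ B) ++ neg (A′ ⧢ B) → Leibniz
  leibniz-from-iv eq = begin
    linExt (lowerᵀ φ) (A ⧢ B)                                     ≡⟨ //-rightDividesˡ (linExt φ (A′ ⧢ B)) _ ⟨
    linExt (lowerᵀ φ) (A ⧢ B) - linExt φ (A′ ⧢ B) + linExt φ (A′ ⧢ B) ≡⟨ +-comm _ (linExt φ (A′ ⧢ B)) ⟩
    linExt φ (A′ ⧢ B) + (linExt (lowerᵀ φ) (A ⧢ B) - linExt φ (A′ ⧢ B)) ≡⟨ cong (_+_ (linExt φ (A′ ⧢ B))) shifted ⟨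
    linExt φ (A′ ⧢ B) + linExt φ (A ⧢ B′)                          ∎
    where
    shifted : linExt φ (A ⧢ B′) ≡ linExt (lowerᵀ φ) (A ⧢ B) - linExt φ (A′ ⧢ B)
    shifted = trans (cong (linExt φ) eq) (linExt-JS-neg φ (A ⧢ B) (A′ ⧢ B))

  leibniz-from-v : A′ ⧢ B ≡ JS (A ⧢ B) ++ neg (A ⧢ B′) → Leibniz
  leibniz-from-v eq = begin
    linExt (lowerᵀ φ) (A ⧢ B)                                     ≡⟨ //-rightDividesˡ (linExt φ (A ⧢ B′)) _ ⟨
    linExt (lowerᵀ φ) (A ⧢ B) - linExt φ (A ⧢ B′) + linExt φ (A ⧢ B′) ≡⟨ cong (_+ linExt φ (A ⧢ B′)) shifted ⟨
    linExt φ (A′ ⧢ B) + linExt φ (A ⧢ B′)                          ∎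
    where
    shifted : linExt φ (A′ ⧢ B) ≡ linExt (lowerᵀ φ) (A ⧢ B) - linExt φ (A ⧢ B′)
    shifted = trans (cong (linExt φ) eq) (linExt-JS-neg φ (A ⧢ B) (A ⧢ B′))

linExt-IS-lowerᵀ : ∀ φ X → AllWords NonEmpty X → linExt (lowerᵀ φ) (IS X) ≡ linExt φ X
linExt-IS-lowerᵀ φ X ne =
  trans (linExt-IS (lowerᵀ φ) X) (linExt-cong-on X (All.map (raiseᵀ-lowerᵀ φ _) ne))

⧢-leibniz : ∀ φ a b → NonEmpty a → NonEmpty b →
  linExt (lowerᵀ φ) (a ⧢ b) ≡ linExt φ (lower a ⧢ b) + linExt φ (a ⧢ lower b)
⧢-leibniz φ a@((+ suc m , u) ∷ x) b@((+ suc k , v) ∷ y) _ _ = begin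
  linExt (lowerᵀ φ) (a ⧢ b)                                 ≡⟨ cong (linExt (lowerᵀ φ)) (⧢-iii m u x k v y) ⟩
  linExt (lowerᵀ φ) (IS (a ⧢ lower b) ++ IS (lower a ⧢ b))   ≡⟨ linExt-++ (lowerᵀ φ) (IS (a ⧢ lower b)) _ ⟩
  linExt (lowerᵀ φ) (IS (a ⧢ lower b)) + linExt (lowerᵀ φ) (IS (lower a ⧢ b))
    ≡⟨ cong₂ _+_ (linExt-IS-lowerᵀ φ _ (⧢-nonEmpty a (lower b) tt)) (linExt-IS-lowerᵀ φ _ (⧢-nonEmpty (lower a) b tt)) ⟩
  linExt φ (a ⧢ lower b) + linExt φ (lower a ⧢ b)             ≡⟨ +-comm (linExt φ (a ⧢ lower b)) _ ⟩
  linExt φ (lower a ⧢ b) + linExt φ (a ⧢ lower b)             ∎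
⧢-leibniz φ a@((+ suc m , u) ∷ x) b@((t@(+ zero) , v) ∷ y) _ _ =
  leibniz-from-iv φ a b (lower a) (lower b) (⧢-iv m u x t v y (+≤+ ℕ.z≤n))
⧢-leibniz φ a@((+ suc m , u) ∷ x) b@((t@(-[1+ _ ]) , v) ∷ y) _ _ =
  leibniz-from-iv φ a b (lower a) (lower b) (⧢-iv m u x t v y -≤+)
⧢-leibniz φ a@((s@(+ zero) , u) ∷ x) b@((t , v) ∷ y) _ _ =
  leibniz-from-v φ a b (lower a) (lower b) (⧢-v s u x t v y (+≤+ ℕ.z≤n))
⧢-leibniz φ a@((s@(-[1+ _ ]) , u) ∷ x) b@((t , v) ∷ y) _ _ =
  leibniz-from-v φ a b (lower a) (lower b) (⧢-v s u x t v y -≤+)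

leftAssoc rightAssoc associator : (Word → ℚ) → Word → Word → Word → ℚ
leftAssoc φ a b c  = linExt (λ m → linExt φ (m ⧢ c)) (a ⧢ b)
rightAssoc φ a b c = linExt (λ n → linExt φ (a ⧢ n)) (b ⧢ c)
associator φ a b c = leftAssoc φ a b c - rightAssoc φ a b c

AssociativeAt : Word → Word → Word → Set
AssociativeAt a b c = ∀ φ → leftAssoc φ a b c ≡ rightAssoc φ a b c

associator-zero : ∀ a b c → AssociativeAt a b c → ∀ φ → associator φ a b c ≡ 0ℚ
associator-zero a b c assoc φ = x≈y⇒x∙y⁻¹≈ε (assoc φ)

associative-from-zero : ∀ a b c → (∀ φ → associator φ a b c ≡ 0ℚ) → AssociativeAt a b c
associative-from-zero a b c vanishes φ = x∙y⁻¹≈ε⇒x≈y _ _ (vanishes φ)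

lowerᵀ-nonEmpty : ∀ φ w → NonEmpty w → lowerᵀ φ w ≡ φ (lower w)
lowerᵀ-nonEmpty φ (_ ∷ _) _ = refl

leftAssoc-leibniz : ∀ φ a b c → NonEmpty a → NonEmpty b → NonEmpty c →
  leftAssoc (lowerᵀ φ) a b c
  ≡ (leftAssoc φ (lower a) b c + leftAssoc φ a (lower b) c) + leftAssoc φ a b (lower c)
leftAssoc-leibniz φ a b c na nb nc = begin
  linExt (λ m → linExt (lowerᵀ φ) (m ⧢ c)) (a ⧢ b)
    ≡⟨ linExt-cong-on (a ⧢ b) (All.map (λ {t} nm → ⧢-leibniz φ (proj₂ t) c nm nc) (⧢-nonEmpty a b na)) ⟩
  linExt (λ m → linExt φ (lower m ⧢ c) + linExt φ (m ⧢ lower c)) (a ⧢ b)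
    ≡⟨ linExt-+ (λ m → linExt φ (lower m ⧢ c)) _ (a ⧢ b) ⟩
  linExt (λ m → linExt φ (lower m ⧢ c)) (a ⧢ b) + leftAssoc φ a b (lower c)
    ≡⟨ cong (_+ leftAssoc φ a b (lower c)) lower-left ⟩
  (leftAssoc φ (lower a) b c + leftAssoc φ a (lower b) c) + leftAssoc φ a b (lower c) ∎
  where
  ψ : Word → ℚ
  ψ m = linExt φ (m ⧢ c)
  lower-left : linExt (ψ ∘ lower) (a ⧢ b) ≡ leftAssoc φ (lower a) b c + leftAssoc φ a (lower b) c
  lower-left = trans (sym (linExt-cong-on (a ⧢ b) (All.map (λ {t} → lowerᵀ-nonEmpty ψ (proj₂ t)) (⧢-nonEmpty a b na))))
                     (⧢-leibniz ψ a b na nb)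

rightAssoc-leibniz : ∀ φ a b c → NonEmpty a → NonEmpty b → NonEmpty c →
  rightAssoc (lowerᵀ φ) a b c
  ≡ (rightAssoc φ (lower a) b c + rightAssoc φ a (lower b) c) + rightAssoc φ a b (lower c)
rightAssoc-leibniz φ a b c na nb nc = begin
  linExt (λ n → linExt (lowerᵀ φ) (a ⧢ n)) (b ⧢ c)
    ≡⟨ linExt-cong-on (b ⧢ c) (All.map (λ {t} nn → ⧢-leibniz φ a (proj₂ t) na nn) (⧢-nonEmpty b c nb)) ⟩
  linExt (λ n → linExt φ (lower a ⧢ n) + linExt φ (a ⧢ lower n)) (b ⧢ c)
    ≡⟨ linExt-+ (λ n → linExt φ (lower a ⧢ n)) _ (b ⧢ c) ⟩
  rightAssoc φ (lower a) b c + linExt (λ n → linExt φ (a ⧢ lower n)) (b ⧢ c)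
    ≡⟨ cong (_+_ (rightAssoc φ (lower a) b c)) lower-right ⟩
  rightAssoc φ (lower a) b c + (rightAssoc φ a (lower b) c + rightAssoc φ a b (lower c))
    ≡⟨ +-assoc (rightAssoc φ (lower a) b c) _ _ ⟨
  (rightAssoc φ (lower a) b c + rightAssoc φ a (lower b) c) + rightAssoc φ a b (lower c) ∎
  where
  χ : Word → ℚ
  χ n = linExt φ (a ⧢ n)
  lower-right : linExt (χ ∘ lower) (b ⧢ c) ≡ rightAssoc φ a (lower b) c + rightAssoc φ a b (lower c)
  lower-right = trans (sym (linExt-cong-on (b ⧢ c) (All.map (λ {t} → lowerᵀ-nonEmpty χ (proj₂ t)) (⧢-nonEmpty b c nb))))
                      (⧢-leibniz χ b c nb nc)

associator-leibniz : ∀ φ a b c → NonEmpty a → NonEmpty b → NonEmpty c →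
  associator (lowerᵀ φ) a b c
  ≡ (associator φ (lower a) b c + associator φ a (lower b) c) + associator φ a b (lower c)
associator-leibniz φ a b c na nb nc = trans
  (cong₂ _-_ (leftAssoc-leibniz φ a b c na nb nc) (rightAssoc-leibniz φ a b c na nb nc))
  (difference-of-sums (leftAssoc φ (lower a) b c) (leftAssoc φ a (lower b) c) (leftAssoc φ a b (lower c))
                      (rightAssoc φ (lower a) b c) (rightAssoc φ a (lower b) c) (rightAssoc φ a b (lower c)))
  where
  difference-of-sums : ∀ x₁ x₂ x₃ y₁ y₂ y₃ →
    (x₁ + x₂) + x₃ - ((y₁ + y₂) + y₃) ≡ ((x₁ - y₁) + (x₂ - y₂)) + (x₃ - y₃)
  difference-of-sums = solve 6 (λ x₁ x₂ x₃ y₁ y₂ y₃ →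
    (x₁ :+ x₂) :+ x₃ :- ((y₁ :+ y₂) :+ y₃) := ((x₁ :- y₁) :+ (x₂ :- y₂)) :+ (x₃ :- y₃)) refl
    where open +-*-Solver

associator-nonEmpty-cong : ∀ {φ ψ} a b c → (∀ w → NonEmpty w → φ w ≡ ψ w) → NonEmpty a →
  associator φ a b c ≡ associator ψ a b c
associator-nonEmpty-cong {φ} {ψ} a b c φ≗ψ na = cong₂ _-_
  (linExt-cong-on (a ⧢ b) (All.map (λ {t} nm → agree (proj₂ t) c nm) (⧢-nonEmpty a b na)))
  (linExt-cong (b ⧢ c) (λ n → agree a n na))
  where
  agree : ∀ m n → NonEmpty m → linExt φ (m ⧢ n) ≡ linExt ψ (m ⧢ n)
  agree m n nm = linExt-cong-on (m ⧢ n) (All.map (λ {t} → φ≗ψ (proj₂ t)) (⧢-nonEmpty m n nm))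

module _ (a b c : Word) (na : NonEmpty a) (nb : NonEmpty b) (nc : NonEmpty c) where
  private
    leibniz : ∀ φ → associator (lowerᵀ φ) a b c
      ≡ (associator φ (lower a) b c + associator φ a (lower b) c) + associator φ a b (lower c)
    leibniz φ = associator-leibniz φ a b c na nb nc

  lower₁-associative : AssociativeAt a b c → AssociativeAt a (lower b) c → AssociativeAt a b (lower c) →
    AssociativeAt (lower a) b c
  lower₁-associative abc ab′c abc′ = associative-from-zero (lower a) b c λ φ →
    zero-summandˡ refl
      (zero-summandˡ (leibniz φ) (associator-zero a b c abc (lowerᵀ φ)) (associator-zero a b (lower c) abc′ φ))
      (associator-zero a (lower b) c ab′c φ)

  lower₂-associative : AssociativeAt a b c → AssociativeAt (lower a) b c → AssociativeAt a b (lower c) →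
    AssociativeAt a (lower b) c
  lower₂-associative abc a′bc abc′ = associative-from-zero a (lower b) c λ φ →
    zero-summandʳ refl
      (zero-summandˡ (leibniz φ) (associator-zero a b c abc (lowerᵀ φ)) (associator-zero a b (lower c) abc′ φ))
      (associator-zero (lower a) b c a′bc φ)

  lower₃-associative : AssociativeAt a b c → AssociativeAt (lower a) b c → AssociativeAt a (lower b) c →
    AssociativeAt a b (lower c)
  lower₃-associative abc a′bc ab′c = associative-from-zero a b (lower c) λ φ →
    zero-summandʳ (leibniz φ) (associator-zero a b c abc (lowerᵀ φ))
      (zero-sum refl (associator-zero (lower a) b c a′bc φ) (associator-zero a (lower b) c ab′c φ))

  unlower-associative : AssociativeAt (lower a) b c → AssociativeAt a (lower b) c → AssociativeAt a b (lower c) →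
    AssociativeAt a b c
  unlower-associative a′bc ab′c abc′ = associative-from-zero a b c λ φ →
    trans (associator-nonEmpty-cong a b c (λ w nw → sym (lowerᵀ-raiseᵀ φ w nw)) na)
      (zero-sum (leibniz (raiseᵀ φ))
        (zero-sum refl (associator-zero (lower a) b c a′bc (raiseᵀ φ)) (associator-zero a (lower b) c ab′c (raiseᵀ φ)))
        (associator-zero a b (lower c) abc′ (raiseᵀ φ)))

associative-[]₁ : ∀ b c → AssociativeAt [] b c
associative-[]₁ b c φ = trans (linExt-single (λ m → linExt φ (m ⧢ c)) b) (sym (linExt-cong (b ⧢ c) (linExt-single φ)))

associative-[]₂ : ∀ a c → AssociativeAt a [] c
associative-[]₂ a c φ = begin
  linExt (λ m → linExt φ (m ⧢ c)) (a ⧢ [])      ≡⟨ cong (linExt (λ m → linExt φ (m ⧢ c))) (⧢-identityʳ a) ⟩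
  linExt (λ m → linExt φ (m ⧢ c)) (single a)    ≡⟨ linExt-single (λ m → linExt φ (m ⧢ c)) a ⟩
  linExt φ (a ⧢ c)                               ≡⟨ linExt-single (λ n → linExt φ (a ⧢ n)) c ⟨
  linExt (λ n → linExt φ (a ⧢ n)) (single c)    ∎

associative-[]₃ : ∀ a b → AssociativeAt a b []
associative-[]₃ a b φ = begin
  linExt (λ m → linExt φ (m ⧢ [])) (a ⧢ b)      ≡⟨ linExt-cong (a ⧢ b) (λ m → trans (cong (linExt φ) (⧢-identityʳ m)) (linExt-single φ m)) ⟩
  linExt φ (a ⧢ b)                               ≡⟨ linExt-single (λ n → linExt φ (a ⧢ n)) b ⟨
  linExt (λ n → linExt φ (a ⧢ n)) (single b)    ≡⟨ cong (linExt (λ n → linExt φ (a ⧢ n))) (⧢-identityʳ b) ⟨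
  linExt (λ n → linExt φ (a ⧢ n)) (b ⧢ [])      ∎

linExt-⧢-i : ∀ φ u x b → linExt φ (((+ 0 , u) ∷ x) ⧢ b) ≡ linExt (φ ∘ ((+ 0 , u) ∷_)) (x ⧢ b)
linExt-⧢-i φ u x b = trans (cong (linExt φ) (⧢-i u x b)) (linExt-pre φ _ (x ⧢ b))

linExt-⧢-ii : ∀ φ a → HeadPositive a → ∀ v y →
  linExt φ (a ⧢ ((+ 0 , v) ∷ y)) ≡ linExt (φ ∘ ((+ 0 , v) ∷_)) (a ⧢ y)
linExt-⧢-ii φ a a>0 v y = trans (cong (linExt φ) (⧢-ii a a>0 v y)) (linExt-pre φ _ (a ⧢ y))

associative-i : ∀ u x b c → AssociativeAt x b c → AssociativeAt ((+ 0 , u) ∷ x) b c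
associative-i u x b c xbc φ = begin
  linExt (λ m → linExt φ (m ⧢ c)) (((+ 0 , u) ∷ x) ⧢ b)  ≡⟨ linExt-⧢-i (λ m → linExt φ (m ⧢ c)) u x b ⟩
  linExt (λ m → linExt φ (((+ 0 , u) ∷ m) ⧢ c)) (x ⧢ b)  ≡⟨ linExt-cong (x ⧢ b) (λ m → linExt-⧢-i φ u m c) ⟩
  leftAssoc φ′ x b c                                       ≡⟨ xbc φ′ ⟩
  rightAssoc φ′ x b c                                      ≡⟨ linExt-cong (b ⧢ c) (λ n → linExt-⧢-i φ u x n) ⟨
  rightAssoc φ ((+ 0 , u) ∷ x) b c                         ∎
  where
  φ′ : Word → ℚ
  φ′ = φ ∘ ((+ 0 , u) ∷_)

associative-ii : ∀ a v y c → HeadPositive a → AssociativeAt a y c → AssociativeAt a ((+ 0 , v) ∷ y) c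
associative-ii a v y c a>0 ayc φ = begin
  linExt (λ m → linExt φ (m ⧢ c)) (a ⧢ ((+ 0 , v) ∷ y))  ≡⟨ linExt-⧢-ii (λ m → linExt φ (m ⧢ c)) a a>0 v y ⟩
  linExt (λ m → linExt φ (((+ 0 , v) ∷ m) ⧢ c)) (a ⧢ y)  ≡⟨ linExt-cong (a ⧢ y) (λ m → linExt-⧢-i φ v m c) ⟩
  leftAssoc φ′ a y c                                       ≡⟨ ayc φ′ ⟩
  rightAssoc φ′ a y c                                      ≡⟨ linExt-cong (y ⧢ c) (λ n → linExt-⧢-ii φ a a>0 v n) ⟨
  linExt (λ n → linExt φ (a ⧢ ((+ 0 , v) ∷ n))) (y ⧢ c)  ≡⟨ linExt-⧢-i (λ n → linExt φ (a ⧢ n)) v y c ⟨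
  rightAssoc φ a ((+ 0 , v) ∷ y) c                         ∎
  where
  φ′ : Word → ℚ
  φ′ = φ ∘ ((+ 0 , v) ∷_)

associative-iii : ∀ m u x k v y w z →
  let a = (+ suc m , u) ∷ x; b = (+ suc k , v) ∷ y in
  AssociativeAt a b z → AssociativeAt a b ((+ 0 , w) ∷ z)
associative-iii m u x k v y w z abz φ = begin
  linExt (λ n → linExt φ (n ⧢ ((+ 0 , w) ∷ z))) (a ⧢ b)
    ≡⟨ linExt-cong-on (a ⧢ b) (All.map (λ {t} n>0 → linExt-⧢-ii φ (proj₂ t) n>0 w z) (⧢-headPositive m u x k v y)) ⟩
  leftAssoc φ′ a b z                                       ≡⟨ abz φ′ ⟩
  rightAssoc φ′ a b z                                      ≡⟨ linExt-cong (b ⧢ z) (λ n → linExt-⧢-ii φ a tt w n) ⟨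
  linExt (λ n → linExt φ (a ⧢ ((+ 0 , w) ∷ n))) (b ⧢ z)  ≡⟨ linExt-⧢-ii (λ n → linExt φ (a ⧢ n)) b tt w z ⟨
  rightAssoc φ a b ((+ 0 , w) ∷ z)                         ∎
  where
  a b : Word
  a = (+ suc m , u) ∷ x
  b = (+ suc k , v) ∷ y
  φ′ : Word → ℚ
  φ′ = φ ∘ ((+ 0 , w) ∷_)

-- Recursing on the tails x, y, z, with the heads as parameters, keeps every
-- recursive call structural.
associative-cons : ∀ x y z s u t v r w → AssociativeAt ((s , u) ∷ x) ((t , v) ∷ y) ((r , w) ∷ z)
associative-cons x y z s u t v r w = exponent-induction³ P
  (λ t r → associative-i u x (B t) (C r) (shorter₁ t r x))
  (λ m r → associative-ii (A (+ suc m)) v y (C r) tt (shorter₂ m r y))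
  (λ m k → associative-iii m u x k v y w z (shorter₃ m k z))
  (λ s t r → lower₁-associative (A s) (B t) (C r) tt tt tt)
  (λ s t r → lower₂-associative (A s) (B t) (C r) tt tt tt)
  (λ s t r → lower₃-associative (A s) (B t) (C r) tt tt tt)
  (λ s t r → unlower-associative (A s) (B t) (C r) tt tt tt)
  s t r
  where
  A B C : ℤ → Word
  A s = (s , u) ∷ x
  B t = (t , v) ∷ y
  C r = (r , w) ∷ z
  P : ℤ → ℤ → ℤ → Set
  P s t r = AssociativeAt (A s) (B t) (C r)
  shorter₁ : ∀ t r x → AssociativeAt x (B t) (C r)
  shorter₁ t r []              = associative-[]₁ (B t) (C r)
  shorter₁ t r ((s′ , u′) ∷ x′) = associative-cons x′ y z s′ u′ t v r w
  shorter₂ : ∀ m r y → AssociativeAt (A (+ suc m)) y (C r)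
  shorter₂ m r []              = associative-[]₂ (A (+ suc m)) (C r)
  shorter₂ m r ((t′ , v′) ∷ y′) = associative-cons x y′ z (+ suc m) u t′ v′ r w
  shorter₃ : ∀ m k z → AssociativeAt (A (+ suc m)) (B (+ suc k)) z
  shorter₃ m k []              = associative-[]₃ (A (+ suc m)) (B (+ suc k))
  shorter₃ m k ((r′ , w′) ∷ z′) = associative-cons x y z′ (+ suc m) u (+ suc k) v r′ w′

⧢-associative : ∀ a b c → AssociativeAt a b c
⧢-associative []            b             c             = associative-[]₁ b c
⧢-associative a@(_ ∷ _)     []            c             = associative-[]₂ a c
⧢-associative a@(_ ∷ _)     b@(_ ∷ _)     []            = associative-[]₃ a b
⧢-associative ((s , u) ∷ x) ((t , v) ∷ y) ((r , w) ∷ z) = associative-cons x y z s u t v r w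

indicator : Word → Word → ℚ
indicator w a with a ≟W w
... | yes _ = 1ℚ
... | no  _ = 0ℚ

coeff-linExt : ∀ X w → coeff X w ≡ linExt (indicator w) X
coeff-linExt []            w = refl
coeff-linExt ((q , a) ∷ X) w with a ≟W w
... | yes _ = cong₂ _+_ (sym (*-identityʳ q)) (coeff-linExt X w)
... | no  _ = trans (coeff-linExt X w) (sym (trans (cong (_+ linExt (indicator w) X) (*-zeroʳ q)) (+-identityˡ _)))

remove : Word → Comb → Comb
remove b = filter (λ t → ¬? (proj₂ t ≟W b))

linExt-remove : ∀ φ b X → linExt φ X ≡ coeff X b * φ b + linExt φ (remove b X)
linExt-remove φ b []            = sym (trans (+-identityʳ _) (*-zeroˡ (φ b)))
linExt-remove φ b ((q , a) ∷ X) with a ≟W b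
... | yes refl = trans (cong (_+_ (q * φ a)) (linExt-remove φ a X)) (regroup q (coeff X a) (φ a) _)
  where
  regroup : ∀ q c f l → q * f + (c * f + l) ≡ (q + c) * f + l
  regroup = solve 4 (λ q c f l → q :* f :+ (c :* f :+ l) := (q :+ c) :* f :+ l) refl
    where open +-*-Solver
... | no  _    = trans (cong (_+_ (q * φ a)) (linExt-remove φ b X)) (swap-front (q * φ a) (coeff X b * φ b) _)
  where
  swap-front : ∀ p r l → p + (r + l) ≡ r + (p + l)
  swap-front = solve 3 (λ p r l → p :+ (r :+ l) := r :+ (p :+ l)) refl
    where open +-*-Solver

coeff-remove-≢ : ∀ b X a → a ≢ b → coeff (remove b X) a ≡ coeff X a
coeff-remove-≢ b []            a a≢b = refl
coeff-remove-≢ b ((q , c) ∷ X) a a≢b with c ≟W b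
... | yes refl with c ≟W a
...   | yes refl = ⊥-elim (a≢b refl)
...   | no  _    = coeff-remove-≢ b X a a≢b
coeff-remove-≢ b ((q , c) ∷ X) a a≢b | no _ with c ≟W a
...   | yes _ = cong (_+_ q) (coeff-remove-≢ b X a a≢b)
...   | no  _ = coeff-remove-≢ b X a a≢b

coeff-remove-≡ : ∀ b X → coeff (remove b X) b ≡ 0ℚ
coeff-remove-≡ b []            = refl
coeff-remove-≡ b ((q , c) ∷ X) with c ≟W b
... | yes _  = coeff-remove-≡ b X
... | no c≢b with c ≟W b
...   | yes c≡b = ⊥-elim (c≢b c≡b)
...   | no  _   = coeff-remove-≡ b X

linExt-vanishing : ∀ φ X → (∀ a → a ∈supp X → φ a ≡ 0ℚ) → linExt φ X ≡ 0ℚ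
linExt-vanishing φ X = go (length X) X ℕP.≤-refl
  where
  go : ∀ n X → length X ℕ.≤ n → (∀ a → a ∈supp X → φ a ≡ 0ℚ) → linExt φ X ≡ 0ℚ
  go _       []            _              _      = refl
  go (suc n) X@((q , b) ∷ X′) (ℕ.s≤s |X′|≤n) vanish = begin
    linExt φ X                                ≡⟨ linExt-remove φ b X ⟩
    coeff X b * φ b + linExt φ (remove b X)   ≡⟨ cong₂ _+_ at-b (go n (remove b X) shorter vanish′) ⟩
    0ℚ + 0ℚ                                   ≡⟨ +-identityʳ 0ℚ ⟩
    0ℚ                                        ∎
    where
    at-b : coeff X b * φ b ≡ 0ℚ
    at-b with coeff X b ℚ.≟ 0ℚ
    ... | yes c≡0 = trans (cong (_* φ b) c≡0) (*-zeroˡ (φ b))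
    ... | no  c≢0 = trans (cong (_*_ (coeff X b)) (vanish b c≢0)) (*-zeroʳ (coeff X b))
    shorter : length (remove b X) ℕ.≤ n
    shorter rewrite LP.filter-reject (λ t → ¬? (proj₂ t ≟W b)) {(q , b)} {X′} (λ b≢b → b≢b refl) =
      ℕP.≤-trans (LP.length-filter _ X′) |X′|≤n
    vanish′ : ∀ a → a ∈supp remove b X → φ a ≡ 0ℚ
    vanish′ a a∈ with a ≟W b
    ... | yes refl = ⊥-elim (a∈ (coeff-remove-≡ b X))
    ... | no  a≢b  = vanish a (λ c≡0 → a∈ (trans (coeff-remove-≢ b X a a≢b) c≡0))

supp-⧢ₗ : (P : Word → Set) → (∀ w → Dec (P w)) → ∀ X Y →
  (∀ a b → a ∈supp X → b ∈supp Y → AllWords P (a ⧢ b)) → ∀ w → w ∈supp (X ⧢ₗ Y) → P w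
supp-⧢ₗ P P? X Y words w w∈ with P? w
... | yes Pw  = Pw
... | no  ¬Pw = ⊥-elim (w∈ (begin
  coeff (X ⧢ₗ Y) w                                                ≡⟨ coeff-linExt (X ⧢ₗ Y) w ⟩
  linExt (indicator w) (X ⧢ₗ Y)                                   ≡⟨ linExt-⧢ₗ (indicator w) X Y ⟩
  linExt (λ a → linExt (λ b → linExt (indicator w) (a ⧢ b)) Y) X ≡⟨ linExt-vanishing _ X (λ a a∈ → linExt-vanishing _ Y (off-w a a∈)) ⟩
  0ℚ                                                              ∎))
  where
  indicator-off : ∀ m → P m → indicator w m ≡ 0ℚ
  indicator-off m Pm with m ≟W w
  ... | yes refl = ⊥-elim (¬Pw Pm)
  ... | no  _    = refl
  off-w : ∀ a → a ∈supp X → ∀ b → b ∈supp Y → linExt (indicator w) (a ⧢ b) ≡ 0ℚ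
  off-w a a∈ b b∈ = trans
    (linExt-cong-on (a ⧢ b) (All.map (λ {t} → indicator-off (proj₂ t)) (words a b a∈ b∈)))
    (linExt-zero (a ⧢ b))

⧢ₗ-assoc : ∀ X Y Z → ((X ⧢ₗ Y) ⧢ₗ Z) ≈ (X ⧢ₗ (Y ⧢ₗ Z))
⧢ₗ-assoc X Y Z w = begin
  coeff ((X ⧢ₗ Y) ⧢ₗ Z) w                                       ≡⟨ coeff-linExt ((X ⧢ₗ Y) ⧢ₗ Z) w ⟩
  linExt φ ((X ⧢ₗ Y) ⧢ₗ Z)                                      ≡⟨ linExt-⧢ₗ φ (X ⧢ₗ Y) Z ⟩
  linExt (λ m → linExt (λ c → linExt φ (m ⧢ c)) Z) (X ⧢ₗ Y)     ≡⟨ linExt-⧢ₗ _ X Y ⟩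
  linExt (λ a → linExt (λ b → linExt (λ m → linExt (λ c → linExt φ (m ⧢ c)) Z) (a ⧢ b)) Y) X
    ≡⟨ linExt-cong X (λ a → linExt-cong Y (λ b → basis a b)) ⟩
  linExt (λ a → linExt (λ b → linExt (λ c → rightAssoc φ a b c) Z) Y) X
    ≡⟨ linExt-cong X (λ a → linExt-⧢ₗ (λ n → linExt φ (a ⧢ n)) Y Z) ⟨
  linExt (λ a → linExt (λ n → linExt φ (a ⧢ n)) (Y ⧢ₗ Z)) X    ≡⟨ linExt-⧢ₗ φ X (Y ⧢ₗ Z) ⟨
  linExt φ (X ⧢ₗ (Y ⧢ₗ Z))                                      ≡⟨ coeff-linExt (X ⧢ₗ (Y ⧢ₗ Z)) w ⟨
  coeff (X ⧢ₗ (Y ⧢ₗ Z)) w                                       ∎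
  where
  φ : Word → ℚ
  φ = indicator w
  basis : ∀ a b → linExt (λ m → linExt (λ c → linExt φ (m ⧢ c)) Z) (a ⧢ b)
                ≡ linExt (λ c → rightAssoc φ a b c) Z
  basis a b = trans (linExt-swap (λ m c → linExt φ (m ⧢ c)) (a ⧢ b) Z)
                    (linExt-cong Z (λ c → ⧢-associative a b c φ))

^ℕ-nonZero : ∀ q → q ≢ 0ℚ → ∀ n → q ^ℕ n ≢ 0ℚ
^ℕ-nonZero q q≢0 zero    ()
^ℕ-nonZero q q≢0 (suc n) qⁿ⁺¹≡0 = ^ℕ-nonZero q q≢0 n (zero-factor q (q ^ℕ n) q≢0 qⁿ⁺¹≡0)

*-inv : ∀ q → q ≢ 0ℚ → q * inv q ≡ 1ℚ
*-inv q q≢0 with q ℚ.≟ 0ℚ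
... | yes q≡0 = ⊥-elim (q≢0 q≡0)
... | no  q≢0 = *-inverseʳ q {{ℚ.≢-nonZero q≢0}}

inv-scale : ∀ q p → p * inv p ≡ 1ℚ → (q * p) * inv (q * p) ≡ 1ℚ → inv p ≡ q * inv (q * p)
inv-scale q p p-inv qp-inv = begin
  inv p                                ≡⟨ *-identityʳ (inv p) ⟨
  inv p * 1ℚ                           ≡⟨ cong (_*_ (inv p)) qp-inv ⟨
  inv p * ((q * p) * inv (q * p))      ≡⟨ regroup (inv p) q p (inv (q * p)) ⟩
  (p * inv p) * (q * inv (q * p))      ≡⟨ cong (_* (q * inv (q * p))) p-inv ⟩
  1ℚ * (q * inv (q * p))               ≡⟨ *-identityˡ _ ⟩
  q * inv (q * p)                      ∎
  where
  regroup : ∀ i q p j → i * ((q * p) * j) ≡ (p * i) * (q * j)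
  regroup = solve 4 (λ i q p j → i :* ((q :* p) :* j) := (p :* i) :* (q :* j)) refl
    where open +-*-Solver

powNeg-pred : ∀ q → q ≢ 0ℚ → ∀ s → powNeg q (s ℤ.- 1ℤ) ≡ q * powNeg q s
powNeg-pred q q≢0 (+ zero)  = refl
powNeg-pred q q≢0 (+ suc n) = inv-scale q (q ^ℕ n)
  (*-inv (q ^ℕ n) (^ℕ-nonZero q q≢0 n)) (*-inv (q ^ℕ suc n) (^ℕ-nonZero q q≢0 (suc n)))
powNeg-pred q q≢0 -[1+ n ]  = cong (powNeg q) (ℤP.neg-minus-pos n 1)

sumVars-++ : ∀ x l l′ → sumVars x (l ++ l′) ≡ sumVars x l + sumVars x l′
sumVars-++ x []      l′ = sym (+-identityˡ _)
sumVars-++ x (i ∷ l) l′ = trans (cong (_+_ (x i)) (sumVars-++ x l l′)) (sym (+-assoc (x i) _ _))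

sumVars-↭ : ∀ x {l l′} → l ↭ l′ → sumVars x l ≡ sumVars x l′
sumVars-↭ x {l} {l′} l↭l′ = begin
  sumVars x l              ≡⟨ LP.foldr-map _+_ x 0ℚ l ⟨
  foldr _+_ 0ℚ (map x l)   ≡⟨ PermₛP.foldr-commMonoid (setoid ℚ) +-0-isCommutativeMonoid (↭⇒↭ₛ (PermP.map⁺ x l↭l′)) ⟩
  foldr _+_ 0ℚ (map x l′)  ≡⟨ LP.foldr-map _+_ x 0ℚ l′ ⟩
  sumVars x l′             ∎

module _ (x : ℕ → ℚ) (x>0 : Positive x) where

  sumVars-nonNeg : ∀ l → 0ℚ ≤ sumVars x l
  sumVars-nonNeg []      = ≤-refl
  sumVars-nonNeg (i ∷ l) = +-mono-≤ (<⇒≤ (x>0 i)) (sumVars-nonNeg l)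

  sumVars-pos : ∀ i l → 0ℚ < sumVars x (i ∷ l)
  sumVars-pos i l = +-mono-<-≤ (x>0 i) (sumVars-nonNeg l)

  private
    E σ : Word → ℚ
    E w = evalF w x
    σ w = sumVars x (bottoms w)

  σ-pos : ∀ w → NonEmpty w → 0ℚ < σ w
  σ-pos ((_ , i) ∷ w) _ = sumVars-pos i (bottoms w)

  evalF-lower : ∀ w → NonEmpty w → E (lower w) ≡ σ w * E w
  evalF-lower w@((s , i) ∷ w′) nw = trans
    (cong (_* E w′) (powNeg-pred (σ w) (≢-sym (<⇒≢ (σ-pos w nw))) s))
    (*-assoc (σ w) _ (E w′))

  linExt-lowerᵀ-evalF : ∀ a b → NonEmpty a → linExt (lowerᵀ E) (a ⧢ b) ≡ (σ a + σ b) * evalFₗ (a ⧢ b) x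
  linExt-lowerᵀ-evalF a b na = trans
    (linExt-cong-on (a ⧢ b) (All.zipWith (λ {t} (nm , perm) → word (proj₂ t) nm perm) (⧢-nonEmpty a b na , ⧢-bottoms a b)))
    (linExt-* (σ a + σ b) E (a ⧢ b))
    where
    word : ∀ m → NonEmpty m → BottomsPerm (bottoms a ++ bottoms b) m → lowerᵀ E m ≡ (σ a + σ b) * E m
    word m@(_ ∷ _) nm perm = begin
      E (lower m)                                   ≡⟨ evalF-lower m nm ⟩
      σ m * E m                                     ≡⟨ cong (_* E m) (sumVars-↭ x perm) ⟩
      sumVars x (bottoms a ++ bottoms b) * E m      ≡⟨ cong (_* E m) (sumVars-++ x (bottoms a) (bottoms b)) ⟩
      (σ a + σ b) * E m                             ∎

  defect : Word → Word → ℚ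
  defect a b = evalFₗ (a ⧢ b) x - E a * E b

  defect-leibniz : ∀ a b → NonEmpty a → NonEmpty b →
    (σ a + σ b) * defect a b ≡ defect (lower a) b + defect a (lower b)
  defect-leibniz a b na nb = begin
    (σ a + σ b) * (evalFₗ (a ⧢ b) x - E a * E b)
      ≡⟨ expand (σ a) (σ b) (evalFₗ (a ⧢ b) x) (E a) (E b) ⟩
    (σ a + σ b) * evalFₗ (a ⧢ b) x - ((σ a * E a) * E b + E a * (σ b * E b))
      ≡⟨ cong₂ _-_ (trans (sym (linExt-lowerᵀ-evalF a b na)) (⧢-leibniz E a b na nb))
                   (cong₂ _+_ (cong (_* E b) (sym (evalF-lower a na))) (cong (_*_ (E a)) (sym (evalF-lower b nb)))) ⟩
    (evalFₗ (lower a ⧢ b) x + evalFₗ (a ⧢ lower b) x) - (E (lower a) * E b + E a * E (lower b))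
      ≡⟨ interchange (evalFₗ (lower a ⧢ b) x) (evalFₗ (a ⧢ lower b) x) (E (lower a) * E b) (E a * E (lower b)) ⟩
    defect (lower a) b + defect a (lower b) ∎
    where
    open +-*-Solver
    expand : ∀ A B L Ea Eb → (A + B) * (L - Ea * Eb) ≡ (A + B) * L - ((A * Ea) * Eb + Ea * (B * Eb))
    expand = solve 5 (λ A B L Ea Eb →
      (A :+ B) :* (L :- Ea :* Eb) := (A :+ B) :* L :- ((A :* Ea) :* Eb :+ Ea :* (B :* Eb))) refl
    interchange : ∀ p q r s → (p + q) - (r + s) ≡ (p - r) + (q - s)
    interchange = solve 4 (λ p q r s → (p :+ q) :- (r :+ s) := (p :- r) :+ (q :- s)) refl

  Multiplicative : Word → Word → Set
  Multiplicative a b = evalFₗ (a ⧢ b) x ≡ E a * E b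

  module _ (a b : Word) (na : NonEmpty a) (nb : NonEmpty b) where
    private
      c : ℚ
      c = σ a + σ b
      leibniz : c * defect a b ≡ defect (lower a) b + defect a (lower b)
      leibniz = defect-leibniz a b na nb
      c*0 : defect a b ≡ 0ℚ → c * defect a b ≡ 0ℚ
      c*0 d≡0 = trans (cong (_*_ c) d≡0) (*-zeroʳ c)

    lower₁-multiplicative : Multiplicative a b → Multiplicative a (lower b) → Multiplicative (lower a) b
    lower₁-multiplicative ab ab′ = x∙y⁻¹≈ε⇒x≈y _ _
      (zero-summandˡ leibniz (c*0 (x≈y⇒x∙y⁻¹≈ε ab)) (x≈y⇒x∙y⁻¹≈ε ab′))

    lower₂-multiplicative : Multiplicative a b → Multiplicative (lower a) b → Multiplicative a (lower b)
    lower₂-multiplicative ab a′b = x∙y⁻¹≈ε⇒x≈y _ _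
      (zero-summandʳ leibniz (c*0 (x≈y⇒x∙y⁻¹≈ε ab)) (x≈y⇒x∙y⁻¹≈ε a′b))

    unlower-multiplicative : Multiplicative (lower a) b → Multiplicative a (lower b) → Multiplicative a b
    unlower-multiplicative a′b ab′ = x∙y⁻¹≈ε⇒x≈y _ _
      (zero-factor c (defect a b) c≢0 (zero-sum leibniz (x≈y⇒x∙y⁻¹≈ε a′b) (x≈y⇒x∙y⁻¹≈ε ab′)))
      where
      c≢0 : c ≢ 0ℚ
      c≢0 = ≢-sym (<⇒≢ (+-mono-<-≤ (σ-pos a na) (<⇒≤ (σ-pos b nb))))

  multiplicative-[]ˡ : ∀ b → Multiplicative [] b
  multiplicative-[]ˡ b = trans (linExt-single E b) (sym (*-identityˡ (E b)))

  multiplicative-[]ʳ : ∀ a → Multiplicative a []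
  multiplicative-[]ʳ a = begin
    evalFₗ (a ⧢ []) x   ≡⟨ cong (λ X → evalFₗ X x) (⧢-identityʳ a) ⟩
    evalFₗ (single a) x ≡⟨ linExt-single E a ⟩
    E a                 ≡⟨ *-identityʳ (E a) ⟨
    E a * 1ℚ            ∎

  -- The factor powNeg _ (+ 0) = inv 1ℚ computes to 1ℚ.
  evalF-zero-column : ∀ u m → E ((+ 0 , u) ∷ m) ≡ E m
  evalF-zero-column u m = *-identityˡ (E m)

  multiplicative-i : ∀ u x′ b → Multiplicative x′ b → Multiplicative ((+ 0 , u) ∷ x′) b
  multiplicative-i u x′ b x′b = begin
    linExt E (((+ 0 , u) ∷ x′) ⧢ b)     ≡⟨ linExt-⧢-i E u x′ b ⟩
    linExt (E ∘ ((+ 0 , u) ∷_)) (x′ ⧢ b) ≡⟨ linExt-cong (x′ ⧢ b) (evalF-zero-column u) ⟩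
    linExt E (x′ ⧢ b)                    ≡⟨ x′b ⟩
    E x′ * E b                           ≡⟨ cong (_* E b) (evalF-zero-column u x′) ⟨
    E ((+ 0 , u) ∷ x′) * E b             ∎

  multiplicative-ii : ∀ a v y → HeadPositive a → Multiplicative a y → Multiplicative a ((+ 0 , v) ∷ y)
  multiplicative-ii a v y a>0 ay = begin
    linExt E (a ⧢ ((+ 0 , v) ∷ y))      ≡⟨ linExt-⧢-ii E a a>0 v y ⟩
    linExt (E ∘ ((+ 0 , v) ∷_)) (a ⧢ y) ≡⟨ linExt-cong (a ⧢ y) (evalF-zero-column v) ⟩
    linExt E (a ⧢ y)                     ≡⟨ ay ⟩
    E a * E y                            ≡⟨ cong (_*_ (E a)) (evalF-zero-column v y) ⟨
    E a * E ((+ 0 , v) ∷ y)              ∎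

  multiplicative-cons : ∀ x′ y s u t v → Multiplicative ((s , u) ∷ x′) ((t , v) ∷ y)
  multiplicative-cons x′ y s u t v = exponent-induction² (λ s t → Multiplicative (A s) (B t))
    (λ t → multiplicative-i u x′ (B t) (shorter₁ t x′))
    (λ m → multiplicative-ii (A (+ suc m)) v y tt (shorter₂ m y))
    (λ s t → lower₁-multiplicative (A s) (B t) tt tt)
    (λ s t → lower₂-multiplicative (A s) (B t) tt tt)
    (λ s t → unlower-multiplicative (A s) (B t) tt tt)
    s t
    where
    A B : ℤ → Word
    A s = (s , u) ∷ x′
    B t = (t , v) ∷ y
    shorter₁ : ∀ t x′ → Multiplicative x′ (B t)
    shorter₁ t []                = multiplicative-[]ˡ (B t)
    shorter₁ t ((s′ , u′) ∷ x″)  = multiplicative-cons x″ y s′ u′ t v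
    shorter₂ : ∀ m y → Multiplicative (A (+ suc m)) y
    shorter₂ m []                = multiplicative-[]ʳ (A (+ suc m))
    shorter₂ m ((t′ , v′) ∷ y′)  = multiplicative-cons x′ y′ (+ suc m) u t′ v′

  ⧢-multiplicative : ∀ a b → Multiplicative a b
  ⧢-multiplicative []            b             = multiplicative-[]ˡ b
  ⧢-multiplicative a@(_ ∷ _)     []            = multiplicative-[]ʳ a
  ⧢-multiplicative ((s , u) ∷ x′) ((t , v) ∷ y) = multiplicative-cons x′ y s u t v

Unique-resp-↭ : ∀ {l l′ : List ℕ} → l ↭ l′ → Unique l → Unique l′
Unique-resp-↭ l↭l′ = PermₛP.Unique-resp-↭ (setoid ℕ) (↭⇒↭ₛ l↭l′)

Unique-++⇒Disjoint : ∀ (l l′ : List ℕ) → Unique (l ++ l′) → Disjoint l l′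
Unique-++⇒Disjoint []      l′ _         (() , _)
Unique-++⇒Disjoint (i ∷ l) l′ (i∉ ∷ _) (here refl , i∈l′) = All.lookup i∉ (MP.∈-++⁺ʳ l i∈l′) refl
Unique-++⇒Disjoint (i ∷ l) l′ (_ ∷ u)  (there j∈l , j∈l′) = Unique-++⇒Disjoint l l′ u (j∈l , j∈l′)

Disjoint-++ˡ : ∀ {l l′ k : List ℕ} → Disjoint l k → Disjoint l′ k → Disjoint (l ++ l′) k
Disjoint-++ˡ {l} l#k l′#k (i∈l++l′ , i∈k) with MP.∈-++⁻ l i∈l++l′
... | inj₁ i∈l  = l#k (i∈l , i∈k)
... | inj₂ i∈l′ = l′#k (i∈l′ , i∈k)

Disjoint-resp-↭ˡ : ∀ {l l′ k : List ℕ} → l ↭ l′ → Disjoint l k → Disjoint l′ k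
Disjoint-resp-↭ˡ l↭l′ l#k (i∈l′ , i∈k) = l#k (PermP.∈-resp-↭ (↭-sym l↭l′) i∈l′ , i∈k)

⊤-sym : ∀ a b → a ⊤ b → b ⊤ a
⊤-sym a b (inj₁ a≡[])        = inj₂ (inj₁ a≡[])
⊤-sym a b (inj₂ (inj₁ b≡[])) = inj₁ b≡[]
⊤-sym a b (inj₂ (inj₂ u))    = inj₂ (inj₂ (Unique-resp-↭ (PermP.++-comm (bottoms a) (bottoms b)) u))

⊤⇒Disjoint : ∀ a b → a ⊤ b → Disjoint (bottoms a) (bottoms b)
⊤⇒Disjoint [] b (inj₁ refl)        (() , _)
⊤⇒Disjoint a [] (inj₂ (inj₁ refl)) (_ , ())
⊤⇒Disjoint a b  (inj₂ (inj₂ u))    = Unique-++⇒Disjoint (bottoms a) (bottoms b) u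

Disjoint⇒⊤ : ∀ a b → Chen a → Chen b → Disjoint (bottoms a) (bottoms b) → a ⊤ b
Disjoint⇒⊤ a b ch-a ch-b a#b = inj₂ (inj₂ (UP.++⁺ (proj₂ ch-a) (proj₂ ch-b) a#b))

chen? : ∀ w → Dec (Chen w)
chen? w = All.all? (λ u → 1 ℕ.≤? u) (bottoms w) ×-dec unique? (bottoms w)

⧢-Chen : ∀ a b → Chen a → Chen b → a ⊤ b → AllWords Chen (a ⧢ b)
⧢-Chen a b ch-a ch-b a⊤b = All.map
  (λ m↭ab → PermP.All-resp-↭ (↭-sym m↭ab) (AllP.++⁺ (proj₁ ch-a) (proj₁ ch-b))
          , Unique-resp-↭ (↭-sym m↭ab) (UP.++⁺ (proj₂ ch-a) (proj₂ ch-b) (⊤⇒Disjoint a b a⊤b)))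
  (⧢-bottoms a b)

⧢-Disjoint : ∀ a b K → Disjoint (bottoms a) K → Disjoint (bottoms b) K →
  AllWords (λ m → Disjoint (bottoms m) K) (a ⧢ b)
⧢-Disjoint a b K a#K b#K = All.map disjoint (⧢-bottoms a b)
  where
  disjoint : ∀ {m} → BottomsPerm (bottoms a ++ bottoms b) m → Disjoint (bottoms m) K
  disjoint m↭ab = Disjoint-resp-↭ˡ (↭-sym m↭ab) (Disjoint-++ˡ a#K b#K)

⧢ₗ-InSpanCh : ∀ X Y → InSpanCh X → InSpanCh Y → X ⊤ₗ Y → InSpanCh (X ⧢ₗ Y)
⧢ₗ-InSpanCh X Y ch-X ch-Y X⊤Y = supp-⧢ₗ Chen chen? X Y
  (λ a b a∈ b∈ → ⧢-Chen a b (ch-X a a∈) (ch-Y b b∈) (X⊤Y a b a∈ b∈))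

⊤ₗ-sym : ∀ X Y → X ⊤ₗ Y → Y ⊤ₗ X
⊤ₗ-sym X Y X⊤Y a b a∈ b∈ = ⊤-sym b a (X⊤Y b a b∈ a∈)

⧢ₗ-⊤ₗ : ∀ X Y Z → InSpanCh X → InSpanCh Y → InSpanCh Z → X ⊤ₗ Y → X ⊤ₗ Z → Y ⊤ₗ Z → (X ⧢ₗ Y) ⊤ₗ Z
⧢ₗ-⊤ₗ X Y Z ch-X ch-Y ch-Z X⊤Y X⊤Z Y⊤Z m c m∈ c∈ =
  Disjoint⇒⊤ m c (⧢ₗ-InSpanCh X Y ch-X ch-Y X⊤Y m m∈) (ch-Z c c∈)
    (supp-⧢ₗ (λ m → Disjoint (bottoms m) (bottoms c)) (λ m → disjoint? (bottoms m) (bottoms c)) X Y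
      (λ a b a∈ b∈ → ⧢-Disjoint a b (bottoms c) (⊤⇒Disjoint a c (X⊤Z a c a∈ c∈)) (⊤⇒Disjoint b c (Y⊤Z b c b∈ c∈)))
      m m∈)

sumVars-local : ∀ x y l → (∀ i → i ∈ l → x i ≡ y i) → sumVars x l ≡ sumVars y l
sumVars-local x y []      x≗y = refl
sumVars-local x y (i ∷ l) x≗y = cong₂ _+_ (x≗y i (here refl)) (sumVars-local x y l (λ j → x≗y j ∘ there))

evalF-local : ∀ a x y → (∀ i → i ∈ bottoms a → x i ≡ y i) → evalF a x ≡ evalF a y
evalF-local []            x y x≗y = refl
evalF-local ((s , i) ∷ w) x y x≗y = cong₂ _*_
  (cong (λ r → powNeg r s) (sumVars-local x y (i ∷ bottoms w) x≗y))
  (evalF-local w x y (λ j → x≗y j ∘ there))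

evalF-⊤F : ∀ a b → a ⊤ b → evalF a ⊤F evalF b
evalF-⊤F a b a⊤b = bottoms a , bottoms b
  , (λ i i∈a i∈b → ⊤⇒Disjoint a b a⊤b (i∈a , i∈b))
  , (λ x y _ _ → evalF-local a x y)
  , (λ x y _ _ → evalF-local b x y)

proposition3p10 :
    -- (1) (Q S^Ch, ⊤, ⧢) is a locality algebra
    ((a b : Word) → Chen a → Chen b → a ⊤ b → b ⊤ a)
    × ((X Y Z : Comb) → InSpanCh X → InSpanCh Y → InSpanCh Z →
        (X ⊤ₗ Y → InSpanCh (X ⧢ₗ Y))
        × (X ⊤ₗ Y → X ⊤ₗ Z → Y ⊤ₗ Z →
             ((X ⧢ₗ Y) ⊤ₗ Z) × (X ⊤ₗ (Y ⧢ₗ Z))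
             × (((X ⧢ₗ Y) ⧢ₗ Z) ≈ (X ⧢ₗ (Y ⧢ₗ Z)))))
    -- (2) F is a locality algebra homomorphism
    × ((a b : Word) → Chen a → Chen b → a ⊤ b →
        (evalF a ⊤F evalF b)
        × ((x : ℕ → ℚ) → Positive x → evalFₗ (a ⧢ b) x ≡ evalF a x * evalF b x))
proposition3p10 =
    (λ a b _ _ → ⊤-sym a b)
  , (λ X Y Z ch-X ch-Y ch-Z →
        ⧢ₗ-InSpanCh X Y ch-X ch-Y
      , λ X⊤Y X⊤Z Y⊤Z →
            ⧢ₗ-⊤ₗ X Y Z ch-X ch-Y ch-Z X⊤Y X⊤Z Y⊤Z
          , ⊤ₗ-sym (Y ⧢ₗ Z) X (⧢ₗ-⊤ₗ Y Z X ch-Y ch-Z ch-X Y⊤Z (⊤ₗ-sym X Y X⊤Y) (⊤ₗ-sym X Z X⊤Z))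
          , ⧢ₗ-assoc X Y Z)
  , (λ a b _ _ a⊤b → evalF-⊤F a b a⊤b , λ x x>0 → ⧢-multiplicative x x>0 a b)
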